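{- For every $\mathbf{S}$-tree $[t]$, $K[t]$ is an FTP-tree.
   Context: For relations with disjoint domains: $\langle R,X\rangle+\langle S,Y\rangle=\langle R\cup S,X\cup Y\rangle$, $\langle R,X\rangle\cdot\langle S,Y\rangle=\langle R\cup S\cup(X\times Y),X\cup Y\rangle$. $\mathbf{S}$-terms are built from an infinite set of $\mathbf{S}$-variables with binary $+$ and $\cdot$; $[t]$ is the class of $t$ modulo the least congruence making $+$ associative and commutative and $\cdot$ associative. $t$ is diversified if no variable occurs twice. For diversified $t$: $K[x]=\langle\emptyset,\{x\}\rangle$, $K[t+s]=K[t]+K[s]$, $K[t\cdot s]=K[t]\cdot K[s]$. Let $C$ be the least set of classes with $[x]\in C$ for each variable $x$, $[t+s]\in C$ whenever $[t],[s]\in C$, and $[x\cdot t]\in C$ whenever $[t]\in C$ and $x$ is a variable; an $\mathbf{S}$-forest is a diversified element of $C$, and an $\mathbf{S}$-tree is an $\mathbf{S}$-forest not of the form $[t+s]$. An FTP-forest is a strict (irreflexive, transitive) partial order $\langle R,X\rangle$ with $X$ a finite set of $\mathbf{S}$-variables such that for all $x,y,z\in X$, if $(x,z),(y,z)\in R$ then $x=y$ or $(x,y)\in R$ or $(y,x)\in R$. An FTP-tree is an FTP-forest with an element $x\in X$ (root) such that $(x,y)\in R$ for every $y\in X$ different from $x$. -}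

module Defs where

open import Data.Nat using (ℕ)
open import Data.List using (List; []; _∷_; [_]; _++_)
open import Data.List.Membership.Propositional using (_∈_)
open import Data.List.Relation.Unary.Unique.Propositional using (Unique)
open import Data.Product using (Σ; _×_; _,_; ∃; ∃-syntax)
open import Data.Sum using (_⊎_)
open import Data.Empty using (⊥)
open import Relation.Nullary using (¬_)
open import Relation.Binary.PropositionalEquality using (_≡_; _≢_)

Var : Set
Var = ℕ

infixl 6 _⊕_
infixl 7 _⊙_
data Term : Set where
  var : Var → Term
  _⊕_ : Term → Term → Term
  _⊙_ : Term → Term → Term

infix 4 _≈_
data _≈_ : Term → Term → Set where
  ≈-refl  : ∀ {t} → t ≈ t
  ≈-sym   : ∀ {t s} → t ≈ s → s ≈ t
  ≈-trans : ∀ {t s u} → t ≈ s → s ≈ u → t ≈ u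
  ⊕-cong  : ∀ {t t' s s'} → t ≈ t' → s ≈ s' → t ⊕ s ≈ t' ⊕ s'
  ⊙-cong  : ∀ {t t' s s'} → t ≈ t' → s ≈ s' → t ⊙ s ≈ t' ⊙ s'
  ⊕-assoc : ∀ {t s u} → (t ⊕ s) ⊕ u ≈ t ⊕ (s ⊕ u)
  ⊕-comm  : ∀ {t s} → t ⊕ s ≈ s ⊕ t
  ⊙-assoc : ∀ {t s u} → (t ⊙ s) ⊙ u ≈ t ⊙ (s ⊙ u)

vars : Term → List Var
vars (var x) = [ x ]
vars (t ⊕ s) = vars t ++ vars s
vars (t ⊙ s) = vars t ++ vars s

Diversified : Term → Set
Diversified t = Unique (vars t)

data Gen : Term → Set where
  gen-var : ∀ x → Gen (var x)
  gen-⊕   : ∀ {t s} → Gen t → Gen s → Gen (t ⊕ s)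
  gen-⊙   : ∀ x {t} → Gen t → Gen (var x ⊙ t)

-- [t] ∈ C  iff  the class of t contains a term generated by the grammar
InC : Term → Set
InC t = ∃[ t' ] (t ≈ t' × Gen t')

-- [t] is an S-forest (diversified is invariant under ≈, so stated on t)
SForest : Term → Set
SForest t = InC t × Diversified t

STree : Term → Set
STree t = SForest t × (¬ (∃[ a ] ∃[ b ] (t ≈ a ⊕ b)))

-- relations ⟨R,X⟩: R a binary relation, X a finite set of variables (as a list)
record Rel : Set₁ where
  constructor ⟨_,_⟩
  field
    R : Var → Var → Set
    X : List Var
open Rel public

_+R_ : Rel → Rel → Rel
⟨ R , X ⟩ +R ⟨ S , Y ⟩ = ⟨ (λ a b → R a b ⊎ S a b) , X ++ Y ⟩

_·R_ : Rel → Rel → Rel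
⟨ R , X ⟩ ·R ⟨ S , Y ⟩ =
  ⟨ (λ a b → R a b ⊎ S a b ⊎ (a ∈ X × b ∈ Y)) , X ++ Y ⟩

-- K[t] (meaningful for diversified t, where the domains are disjoint)
K : Term → Rel
K (var x) = ⟨ (λ _ _ → ⊥) , [ x ] ⟩
K (t ⊕ s) = K t +R K s
K (t ⊙ s) = K t ·R K s

record FTPForest (ρ : Rel) : Set where
  field
    onX      : ∀ {x y} → R ρ x y → x ∈ X ρ × y ∈ X ρ
    irrefl   : ∀ {x} → ¬ R ρ x x
    trans    : ∀ {x y z} → R ρ x y → R ρ y z → R ρ x z
    forest   : ∀ {x y z} → x ∈ X ρ → y ∈ X ρ → z ∈ X ρ →
               R ρ x z → R ρ y z → x ≡ y ⊎ R ρ x y ⊎ R ρ y x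

FTPTree : Rel → Set
FTPTree ρ = FTPForest ρ × ∃[ r ] (r ∈ X ρ × (∀ y → y ∈ X ρ → y ≢ r → R ρ r y))

module Submission where

-- The class [t] contains a term t' generated by the grammar of C
-- (variables, sums, and products x·s with x a variable).  Call two relations equivalent (_≅_) when they have the
--       same pairs and their domains are permutations of each other.  The
--       operations +R and ·R are congruences for _≅_, +R is associative and
--       commutative and ·R is associative up to _≅_; hence t ≈ t' implies
--       K t ≅ K t'.  Being an FTP-tree and having a duplicate-free domain are
--       invariant under _≅_, so we may replace t by t'.
--   (2) Closure.  A disjoint sum of FTP-forests is an FTP-forest, and the
--       cone x·σ over an FTP-forest σ with a fresh apex x is an FTP-tree
--       with root x; a single point is an FTP-tree.
--   (3) Induction on the generation of t'.  Every generated diversified term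
--       gives an FTP-forest; if it is moreover not a sum, it is a variable or
--       a cone, hence an FTP-tree.

open import Defs
open import Function using (_∘_)
open import Data.List using (List; []; _∷_; [_]; _++_)
open import Data.List.Membership.Propositional using (_∈_; _∉_)
open import Data.List.Membership.Propositional.Properties using (∈-++⁺ˡ; ∈-++⁺ʳ; ∈-++⁻)
open import Data.List.Relation.Unary.Any using (here; there)
open import Data.List.Relation.Unary.All using (lookup)
import Data.List.Relation.Unary.All.Properties as All
open import Data.List.Relation.Unary.Unique.Propositional using (Unique; []; _∷_)
open import Data.List.Relation.Unary.Unique.Propositional.Properties using (Unique[x∷xs]⇒x∉xs)
open import Data.List.Relation.Binary.Disjoint.Propositional using (Disjoint)
open import Data.List.Relation.Binary.Permutation.Propositional using (_↭_; ↭-refl; ↭-sym; ↭-trans; ↭⇒↭ₛ)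
open import Data.List.Relation.Binary.Permutation.Propositional.Properties using (∈-resp-↭)
  renaming (++⁺ to ↭-++⁺; ++-assoc to ↭-++-assoc; ++-comm to ↭-++-comm)
import Data.List.Relation.Binary.Permutation.Setoid.Properties as PermSetoid
open import Data.Product using (_×_; _,_; proj₁; proj₂)
import Data.Product as Product
open import Data.Sum using (_⊎_; inj₁; inj₂)
import Data.Sum as Sum
open import Data.Empty using (⊥; ⊥-elim)
open import Relation.Nullary using (¬_)
open import Relation.Binary.Core using (_⇒_)
open import Relation.Binary.PropositionalEquality using (_≡_; _≢_; refl; sym; cong₂; subst; setoid)

unique-++⁻ : ∀ {A : Set} (xs : List A) {ys} → Unique (xs ++ ys) → Unique xs × Unique ys × Disjoint xs ys
unique-++⁻ [] u = [] , u , λ { (() , _) }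
unique-++⁻ (x ∷ xs) {ys} (x∉xs++ys ∷ u) with unique-++⁻ xs u | All.++⁻ xs x∉xs++ys
... | uxs , uys , xs#ys | x∉xs , x∉ys = (x∉xs ∷ uxs) , uys , x∷xs#ys
  where
  x∷xs#ys : Disjoint (x ∷ xs) ys
  x∷xs#ys (here refl , v∈ys) = lookup x∉ys v∈ys refl
  x∷xs#ys (there v∈xs , v∈ys) = xs#ys (v∈xs , v∈ys)

unique-resp-↭ : ∀ {A : Set} {xs ys : List A} → xs ↭ ys → Unique xs → Unique ys
unique-resp-↭ = PermSetoid.Unique-resp-↭ (setoid _) ∘ ↭⇒↭ₛ

infix 4 _≅_
record _≅_ (ρ σ : Rel) : Set where
  field
    to   : R ρ ⇒ R σ
    from : R σ ⇒ R ρ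
    dom  : X ρ ↭ X σ
open _≅_

≅-refl : ∀ {ρ} → ρ ≅ ρ
≅-refl = record { to = λ r → r ; from = λ r → r ; dom = ↭-refl }

≅-sym : ∀ {ρ σ} → ρ ≅ σ → σ ≅ ρ
≅-sym e = record { to = from e ; from = to e ; dom = ↭-sym (dom e) }

≅-trans : ∀ {ρ σ τ} → ρ ≅ σ → σ ≅ τ → ρ ≅ τ
≅-trans e f = record { to = to f ∘ to e ; from = from e ∘ from f ; dom = ↭-trans (dom e) (dom f) }

+R-cong : ∀ {ρ ρ' σ σ'} → ρ ≅ ρ' → σ ≅ σ' → ρ +R σ ≅ ρ' +R σ'
+R-cong e f = record
  { to   = Sum.map (to e) (to f)
  ; from = Sum.map (from e) (from f)
  ; dom  = ↭-++⁺ (dom e) (dom f)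
  }

·R-cong : ∀ {ρ ρ' σ σ'} → ρ ≅ ρ' → σ ≅ σ' → ρ ·R σ ≅ ρ' ·R σ'
·R-cong e f = record
  { to   = Sum.map (to e) (Sum.map (to f) (Product.map (∈-resp-↭ (dom e)) (∈-resp-↭ (dom f))))
  ; from = Sum.map (from e) (Sum.map (from f)
             (Product.map (∈-resp-↭ (↭-sym (dom e))) (∈-resp-↭ (↭-sym (dom f)))))
  ; dom  = ↭-++⁺ (dom e) (dom f)
  }

+R-assoc : ∀ ρ σ τ → (ρ +R σ) +R τ ≅ ρ +R (σ +R τ)
+R-assoc ρ σ τ = record { to = Sum.assocʳ ; from = Sum.assocˡ ; dom = ↭-++-assoc (X ρ) (X σ) (X τ) }

+R-comm : ∀ ρ σ → ρ +R σ ≅ σ +R ρ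
+R-comm ρ σ = record { to = Sum.swap ; from = Sum.swap ; dom = ↭-++-comm (X ρ) (X σ) }

-- In (ρ·σ)·τ the cross pairs from X ρ ++ X σ to X τ are split according to
-- the origin of the source; symmetrically for ρ·(σ·τ).
·R-assoc : ∀ ρ σ τ → (ρ ·R σ) ·R τ ≅ ρ ·R (σ ·R τ)
·R-assoc ρ σ τ = record { to = to′ ; from = from′ ; dom = ↭-++-assoc (X ρ) (X σ) (X τ) }
  where
  to′ : R ((ρ ·R σ) ·R τ) ⇒ R (ρ ·R (σ ·R τ))
  to′ (inj₁ (inj₁ r))                  = inj₁ r
  to′ (inj₁ (inj₂ (inj₁ r)))           = inj₂ (inj₁ (inj₁ r))
  to′ (inj₁ (inj₂ (inj₂ (a∈ρ , b∈σ)))) = inj₂ (inj₂ (a∈ρ , ∈-++⁺ˡ b∈σ))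
  to′ (inj₂ (inj₁ r))                  = inj₂ (inj₁ (inj₂ (inj₁ r)))
  to′ (inj₂ (inj₂ (a∈ρσ , b∈τ))) with ∈-++⁻ (X ρ) a∈ρσ
  ... | inj₁ a∈ρ = inj₂ (inj₂ (a∈ρ , ∈-++⁺ʳ (X σ) b∈τ))
  ... | inj₂ a∈σ = inj₂ (inj₁ (inj₂ (inj₂ (a∈σ , b∈τ))))
  from′ : R (ρ ·R (σ ·R τ)) ⇒ R ((ρ ·R σ) ·R τ)
  from′ (inj₁ r)                            = inj₁ (inj₁ r)
  from′ (inj₂ (inj₁ (inj₁ r)))              = inj₁ (inj₂ (inj₁ r))
  from′ (inj₂ (inj₁ (inj₂ (inj₁ r))))       = inj₂ (inj₁ r)
  from′ (inj₂ (inj₁ (inj₂ (inj₂ (a∈σ , b∈τ))))) = inj₂ (inj₂ (∈-++⁺ʳ (X ρ) a∈σ , b∈τ))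
  from′ (inj₂ (inj₂ (a∈ρ , b∈στ))) with ∈-++⁻ (X σ) b∈στ
  ... | inj₁ b∈σ = inj₁ (inj₂ (inj₂ (a∈ρ , b∈σ)))
  ... | inj₂ b∈τ = inj₂ (inj₂ (∈-++⁺ˡ a∈ρ , b∈τ))

K-resp-≈ : ∀ {t s} → t ≈ s → K t ≅ K s
K-resp-≈ ≈-refl                  = ≅-refl
K-resp-≈ (≈-sym e)               = ≅-sym (K-resp-≈ e)
K-resp-≈ (≈-trans e f)           = ≅-trans (K-resp-≈ e) (K-resp-≈ f)
K-resp-≈ (⊕-cong e f)            = +R-cong (K-resp-≈ e) (K-resp-≈ f)
K-resp-≈ (⊙-cong e f)            = ·R-cong (K-resp-≈ e) (K-resp-≈ f)
K-resp-≈ (⊕-assoc {t} {s} {u})   = +R-assoc (K t) (K s) (K u)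
K-resp-≈ (⊕-comm {t} {s})        = +R-comm (K t) (K s)
K-resp-≈ (⊙-assoc {t} {s} {u})   = ·R-assoc (K t) (K s) (K u)

X-K : ∀ t → X (K t) ≡ vars t
X-K (var x) = refl
X-K (t ⊕ s) = cong₂ _++_ (X-K t) (X-K s)
X-K (t ⊙ s) = cong₂ _++_ (X-K t) (X-K s)

FTPForest-resp-≅ : ∀ {ρ σ} → ρ ≅ σ → FTPForest ρ → FTPForest σ
FTPForest-resp-≅ {ρ} {σ} e F = record
  { onX    = Product.map (∈-resp-↭ (dom e)) (∈-resp-↭ (dom e)) ∘ F.onX ∘ from e
  ; irrefl = F.irrefl ∘ from e
  ; trans  = λ p q → to e (F.trans (from e p) (from e q))
  ; forest = λ x∈ y∈ z∈ p q →
      Sum.map₂ (Sum.map (to e) (to e)) (F.forest (back x∈) (back y∈) (back z∈) (from e p) (from e q))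
  }
  where
  module F = FTPForest F
  back : ∀ {v} → v ∈ X σ → v ∈ X ρ
  back = ∈-resp-↭ (↭-sym (dom e))

FTPTree-resp-≅ : ∀ {ρ σ} → ρ ≅ σ → FTPTree ρ → FTPTree σ
FTPTree-resp-≅ e (F , r , r∈ , r<) =
  FTPForest-resp-≅ e F , r , ∈-resp-↭ (dom e) r∈ ,
  λ y y∈ y≢r → to e (r< y (∈-resp-↭ (↭-sym (dom e)) y∈) y≢r)

point : Var → Rel
point x = ⟨ (λ _ _ → ⊥) , [ x ] ⟩

point-tree : ∀ x → FTPTree (point x)
point-tree x = forest , x , here refl , only-root
  where
  forest : FTPForest (point x)
  forest = record { onX = λ () ; irrefl = λ () ; trans = λ () ; forest = λ _ _ _ () }
  only-root : ∀ y → y ∈ [ x ] → y ≢ x → ⊥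
  only-root y (here y≡x) y≢x = y≢x y≡x

-- The sum of FTP-forests on disjoint domains is an FTP-forest: a pair of the
-- sum lies in one summand, and two pairs sharing an element lie in the same one.
sum-forest : ∀ {ρ σ} → FTPForest ρ → FTPForest σ → Disjoint (X ρ) (X σ) → FTPForest (ρ +R σ)
sum-forest {ρ} {σ} F G ρ#σ = record { onX = onX ; irrefl = irrefl ; trans = trans ; forest = forest }
  where
  module F = FTPForest F
  module G = FTPForest G
  clash : ∀ {v} → v ∈ X ρ → v ∈ X σ → ⊥
  clash v∈ρ v∈σ = ρ#σ (v∈ρ , v∈σ)
  onX : ∀ {a b} → R (ρ +R σ) a b → a ∈ X (ρ +R σ) × b ∈ X (ρ +R σ)
  onX (inj₁ r) = Product.map ∈-++⁺ˡ ∈-++⁺ˡ (F.onX r)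
  onX (inj₂ r) = Product.map (∈-++⁺ʳ (X ρ)) (∈-++⁺ʳ (X ρ)) (G.onX r)
  irrefl : ∀ {a} → ¬ R (ρ +R σ) a a
  irrefl = Sum.[ F.irrefl , G.irrefl ]
  trans : ∀ {a b c} → R (ρ +R σ) a b → R (ρ +R σ) b c → R (ρ +R σ) a c
  trans (inj₁ p) (inj₁ q) = inj₁ (F.trans p q)
  trans (inj₁ p) (inj₂ q) = ⊥-elim (clash (proj₂ (F.onX p)) (proj₁ (G.onX q)))
  trans (inj₂ p) (inj₁ q) = ⊥-elim (clash (proj₁ (F.onX q)) (proj₂ (G.onX p)))
  trans (inj₂ p) (inj₂ q) = inj₂ (G.trans p q)
  forest : ∀ {a b c} → a ∈ X (ρ +R σ) → b ∈ X (ρ +R σ) → c ∈ X (ρ +R σ) →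
           R (ρ +R σ) a c → R (ρ +R σ) b c → a ≡ b ⊎ R (ρ +R σ) a b ⊎ R (ρ +R σ) b a
  forest _ _ _ (inj₁ p) (inj₁ q) =
    Sum.map₂ (Sum.map inj₁ inj₁) (F.forest (proj₁ (F.onX p)) (proj₁ (F.onX q)) (proj₂ (F.onX p)) p q)
  forest _ _ _ (inj₁ p) (inj₂ q) = ⊥-elim (clash (proj₂ (F.onX p)) (proj₂ (G.onX q)))
  forest _ _ _ (inj₂ p) (inj₁ q) = ⊥-elim (clash (proj₂ (F.onX q)) (proj₂ (G.onX p)))
  forest _ _ _ (inj₂ p) (inj₂ q) =
    Sum.map₂ (Sum.map inj₂ inj₂) (G.forest (proj₁ (G.onX p)) (proj₁ (G.onX q)) (proj₂ (G.onX p)) p q)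

-- The cone x·σ over an FTP-forest σ with a fresh apex x is an FTP-tree rooted
-- at x: the new pairs are exactly (x, b) for b ∈ X σ, so x is below every
-- element and nothing is below x.
cone-tree : ∀ {σ} x → FTPForest σ → x ∉ X σ → FTPTree (point x ·R σ)
cone-tree {σ} x G x∉σ = record { onX = onX ; irrefl = irrefl ; trans = trans ; forest = forest } ,
                        x , here refl , below-root
  where
  module G = FTPForest G
  C = point x ·R σ
  onX : ∀ {a b} → R C a b → a ∈ X C × b ∈ X C
  onX (inj₂ (inj₁ r))                 = Product.map there there (G.onX r)
  onX (inj₂ (inj₂ (here refl , b∈σ))) = here refl , there b∈σ
  irrefl : ∀ {a} → ¬ R C a a
  irrefl (inj₂ (inj₁ r))                 = G.irrefl r
  irrefl (inj₂ (inj₂ (here refl , x∈σ))) = x∉σ x∈σ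
  trans : ∀ {a b c} → R C a b → R C b c → R C a c
  trans (inj₂ (inj₁ p)) (inj₂ (inj₁ q))              = inj₂ (inj₁ (G.trans p q))
  trans (inj₂ (inj₁ p)) (inj₂ (inj₂ (here refl , _))) = ⊥-elim (x∉σ (proj₂ (G.onX p)))
  trans (inj₂ (inj₂ (here refl , _))) (inj₂ (inj₁ q)) = inj₂ (inj₂ (here refl , proj₂ (G.onX q)))
  trans (inj₂ (inj₂ (_ , x∈σ))) (inj₂ (inj₂ (here refl , _))) = ⊥-elim (x∉σ x∈σ)
  forest : ∀ {a b c} → a ∈ X C → b ∈ X C → c ∈ X C → R C a c → R C b c → a ≡ b ⊎ R C a b ⊎ R C b a
  forest _ _ _ (inj₂ (inj₁ p)) (inj₂ (inj₁ q)) =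
    Sum.map₂ (Sum.map (inj₂ ∘ inj₁) (inj₂ ∘ inj₁))
             (G.forest (proj₁ (G.onX p)) (proj₁ (G.onX q)) (proj₂ (G.onX p)) p q)
  forest _ _ _ (inj₂ (inj₁ p)) (inj₂ (inj₂ (here refl , _))) =
    inj₂ (inj₂ (inj₂ (inj₂ (here refl , proj₁ (G.onX p)))))
  forest _ _ _ (inj₂ (inj₂ (here refl , _))) (inj₂ (inj₁ q)) =
    inj₂ (inj₁ (inj₂ (inj₂ (here refl , proj₁ (G.onX q)))))
  forest _ _ _ (inj₂ (inj₂ (here refl , _))) (inj₂ (inj₂ (here refl , _))) = inj₁ refl
  below-root : ∀ y → y ∈ X C → y ≢ x → R C x y
  below-root y (here y≡x) y≢x = ⊥-elim (y≢x y≡x)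
  below-root y (there y∈σ) _  = inj₂ (inj₂ (here refl , y∈σ))

generated-forest : ∀ {t} → Gen t → Unique (X (K t)) → FTPForest (K t)
generated-forest (gen-var x) _ = proj₁ (point-tree x)
generated-forest (gen-⊕ {t} g h) u with unique-++⁻ (X (K t)) u
... | ut , us , t#s = sum-forest (generated-forest g ut) (generated-forest h us) t#s
generated-forest (gen-⊙ x g) u@(_ ∷ us) =
  proj₁ (cone-tree x (generated-forest g us) (Unique[x∷xs]⇒x∉xs u))

generated-tree : ∀ {t} → Gen t → Unique (X (K t)) → (∀ {a b} → t ≢ a ⊕ b) → FTPTree (K t)
generated-tree (gen-var x) _ _ = point-tree x
generated-tree (gen-⊕ _ _) _ not-sum = ⊥-elim (not-sum refl)
generated-tree (gen-⊙ x g) u@(_ ∷ us) _ =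
  cone-tree x (generated-forest g us) (Unique[x∷xs]⇒x∉xs u)

proposition5p2 : (t : Term) → STree t → FTPTree (K t)
proposition5p2 t (((t′ , t≈t′ , gen) , diversified) , not-sum) =
  FTPTree-resp-≅ (≅-sym K-t≅K-t′) (generated-tree gen unique-t′ t′-not-sum)
  where
  K-t≅K-t′ : K t ≅ K t′
  K-t≅K-t′ = K-resp-≈ t≈t′
  unique-t′ : Unique (X (K t′))
  unique-t′ = unique-resp-↭ (dom K-t≅K-t′) (subst Unique (sym (X-K t)) diversified)
  t′-not-sum : ∀ {a b} → t′ ≢ a ⊕ b
  t′-not-sum refl = not-sum (_ , _ , t≈t′)
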